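{- Let $q$ be a prime power and let $W(x,y)=x^{2d+4}+\sum_{i=d}^{2d+4}A_i x^{2d+4-i}y^i$ ($A_d\neq 0$) be the Hamming weight enumerator of a self-dual linear code over $\mathbb{F}_q$ of length $n=2d+4$ and minimum distance $d$ (so the genus $g=n/2+1-d$ equals $3$). Set $A_0=1$ and $A_1=\cdots=A_{d-1}=0$. Then \[ \sum_{i=0}^{d+3} A_{i}\binom{2d+4-i}{d+1}=q \sum_{i=0}^{d+1}A_{i}\binom{2d+4-i}{d+3}. \] -}

module Defs where

open import Level using (0ℓ)
open import Data.Nat as ℕ using (ℕ; zero; suc; _≤_)
open import Data.Product using (_×_; ∃; ∃-syntax; _,_)
open import Data.List using (List; []; _∷_; length; filter; cartesianProductWith)
open import Data.List.Membership.Propositional using (_∈_)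
open import Data.List.Relation.Unary.Unique.Propositional using (Unique)
open import Data.Vec using (Vec; []; _∷_; replicate; zipWith; foldr; toList)
open import Relation.Nullary using (¬_; Dec; yes; no)
open import Relation.Nullary.Decidable using (_×-dec_)
open import Relation.Unary using (Pred; Decidable)
open import Relation.Binary.PropositionalEquality using (_≡_)
open import Relation.Binary.Definitions using (DecidableEquality)
open import Algebra.Structures using (IsCommutativeRing)

record FiniteField : Set₁ where
  infixl 6 _+_
  infixl 7 _*_
  field
    Carrier : Set
    _+_ _*_ : Carrier → Carrier → Carrier
    -_ : Carrier → Carrier
    0# 1# : Carrier
    isCommutativeRing : IsCommutativeRing _≡_ _+_ _*_ -_ 0# 1#
    0≢1 : ¬ (0# ≡ 1#)
    inverse : ∀ x → ¬ (x ≡ 0#) → ∃[ y ] (x * y ≡ 1#)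
    _≟_ : DecidableEquality Carrier
    elements : List Carrier
    complete : ∀ x → x ∈ elements
    unique : Unique elements

  size : ℕ
  size = length elements

module _ (F : FiniteField) where
  open FiniteField F

  zeros : ∀ {n} → Vec Carrier n
  zeros = replicate _ 0#

  dot : ∀ {n} → Vec Carrier n → Vec Carrier n → Carrier
  dot u v = foldr _ _+_ 0# (zipWith _*_ u v)

  weight : ∀ {n} → Vec Carrier n → ℕ
  weight [] = 0
  weight (x ∷ v) with x ≟ 0#
  ... | yes _ = weight v
  ... | no  _ = suc (weight v)

  allVecs : ∀ n → List (Vec Carrier n)
  allVecs zero = [] ∷ []
  allVecs (suc n) = cartesianProductWith _∷_ elements (allVecs n)

  record LinearCode (n : ℕ) : Set₁ where
    field
      _∈C : Pred (Vec Carrier n) 0ℓ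
      _∈C? : Decidable _∈C
      zero-mem : zeros ∈C
      +-closed : ∀ u v → u ∈C → v ∈C → zipWith _+_ u v ∈C
      scale-closed : ∀ a v → v ∈C → Data.Vec.map (a *_) v ∈C

  module _ {n : ℕ} (𝒞 : LinearCode n) where
    open LinearCode 𝒞

    SelfDual : Set
    SelfDual = (∀ v → v ∈C → ∀ c → c ∈C → dot v c ≡ 0#)
             × (∀ v → (∀ c → c ∈C → dot v c ≡ 0#) → v ∈C)

    MinimumDistance : ℕ → Set
    MinimumDistance d = (∃[ c ] (c ∈C × ¬ (c ≡ zeros) × weight c ≡ d))
                      × (∀ c → c ∈C → ¬ (c ≡ zeros) → d ≤ weight c)

    A : ℕ → ℕ
    A i = length (filter (λ v → (v ∈C?) ×-dec (weight v ℕ.≟ i)) (allVecs n))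

-- For a set p of coordinates, compare the codewords vanishing on p with the
-- vectors of the dual code that vanish off p. Puncturing or shortening at the first
-- coordinate gives, by induction on the length, |C(p)| · q^|p| = |C| · |C⊥[p]|.
-- Summing over all p with |p| = ν counts each codeword c exactly binom(n − wt c, ν)
-- times, so q^ν Σ_{c ∈ C} binom(n − wt c, ν) = |C| Σ_{u ∈ C⊥} binom(n − wt u, n − ν).
-- For a self-dual code C⊥ = C and |C|² = q^n; with n = 2d + 4 and ν = d + 1 this is
-- q^(d+1) times the stated identity.

module Submission where

open import Defs
open import Level using (0ℓ)
open import Data.Nat using (ℕ; zero; suc; z<s; s<s; NonZero)
import Data.Nat as ℕ
import Data.Nat.Properties as ℕₚ
open import Data.Nat.Combinatorics using (_C_; nCk+nC[k+1]≡[n+1]C[k+1]; k>n⇒nCk≡0)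
open import Data.Nat.ListAction using (sum)
open import Data.Nat.Tactic.RingSolver using (solve-∀)
open import Data.Unit using (⊤; tt)
open import Data.Product using (_×_; _,_; ∃-syntax; proj₁; proj₂)
open import Data.List using (List; []; _∷_; _++_; map; cartesianProductWith; upTo)
open import Data.List.Membership.Propositional using (_∈_; lose)
open import Data.List.Membership.Propositional.Properties
  using (∈-cartesianProductWith⁺; ∈-upTo⁺; ∈-upTo⁻; ∈-length)
open import Data.List.Relation.Unary.Any as Any using (here; any?)
open import Data.List.Relation.Unary.All as All using (all?)
open import Data.List.Relation.Unary.Unique.Propositional.Properties using (upTo⁺)
open import Data.Vec using (Vec; []; _∷_; zipWith)
import Data.Vec as Vec
open import Data.Vec.Properties using (zipWith-identityˡ; zipWith-inverseʳ)
open import Data.Fin.Subset as Subset using (Subset; inside; outside; ∁; ∣_∣)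
open import Data.Fin.Subset.Properties using (∣p∣≤n; ∣∁p∣≡n∸∣p∣; ∣⊤∣≡n)
open import Algebra.Bundles using (CommutativeRing)
import Algebra.Properties.Ring as RingProperties
import Algebra.Properties.CommutativeSemigroup as CommutativeSemigroupProperties
open import Function using (_∘_; _⇔_; mk⇔; Equivalence)
open import Relation.Nullary using (¬_; Dec; yes; no; contradiction)
open import Relation.Nullary.Decidable using (map′; _×-dec_; _→-dec_; ¬?; decidable-stable)
open import Relation.Binary.Definitions using (tri<; tri≈; tri>)
open import Relation.Binary.PropositionalEquality

module ℕ* = CommutativeSemigroupProperties ℕₚ.*-commutativeSemigroup

module Sums where

  open import Data.Nat using (_+_; _*_)
  open import Data.Nat.ListAction.Properties using (sum-++)
  open import Data.List using (filter; length)
  open import Data.List.Properties using (map-cong; map-∘; map-++)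
  open import Data.List.Membership.Propositional using (_∉_)
  open import Data.List.Relation.Unary.Any using (there)
  open import Data.List.Relation.Unary.All.Properties using (All¬⇒¬Any)
  open import Data.List.Relation.Unary.Unique.Propositional using (Unique)
  open import Data.List.Relation.Unary.AllPairs using (_∷_)
  open import Data.Nat.Properties using (*-distribˡ-+; *-zeroʳ; *-comm; +-identityʳ)
  open import Algebra.Properties.CommutativeSemigroup ℕₚ.+-commutativeSemigroup using (interchange)
  open ℕ* using (x∙yz≈y∙xz)

  ∑ : {X : Set} → List X → (X → ℕ) → ℕ
  ∑ xs f = sum (map f xs)

  syntax ∑ xs (λ x → e) = ∑[ x ∈ xs ] e

  module _ {X : Set} where

    ∑-cong : ∀ (xs : List X) {f g : X → ℕ} → (∀ x → f x ≡ g x) → ∑ xs f ≡ ∑ xs g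
    ∑-cong xs f≗g = cong sum (map-cong f≗g xs)

    ∑-zero : ∀ (xs : List X) {f : X → ℕ} → (∀ x → f x ≡ 0) → ∑ xs f ≡ 0
    ∑-zero []       f≗0 = refl
    ∑-zero (x ∷ xs) f≗0 = cong₂ _+_ (f≗0 x) (∑-zero xs f≗0)

    ∑-+ : ∀ (xs : List X) (f g : X → ℕ) → ∑[ x ∈ xs ] (f x + g x) ≡ ∑ xs f + ∑ xs g
    ∑-+ []       f g = refl
    ∑-+ (x ∷ xs) f g = trans (cong (f x + g x +_) (∑-+ xs f g)) (interchange (f x) (g x) (∑ xs f) (∑ xs g))

    ∑-*ˡ : ∀ (xs : List X) (c : ℕ) (f : X → ℕ) → ∑[ x ∈ xs ] (c * f x) ≡ c * ∑ xs f
    ∑-*ˡ []       c f = sym (*-zeroʳ c)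
    ∑-*ˡ (x ∷ xs) c f = trans (cong (c * f x +_) (∑-*ˡ xs c f)) (sym (*-distribˡ-+ c (f x) (∑ xs f)))

    ∑-*ʳ : ∀ (xs : List X) (c : ℕ) (f : X → ℕ) → ∑[ x ∈ xs ] (f x * c) ≡ ∑ xs f * c
    ∑-*ʳ xs c f = trans (∑-cong xs (λ x → *-comm (f x) c)) (trans (∑-*ˡ xs c f) (*-comm c (∑ xs f)))

    ∑-++ : ∀ (xs ys : List X) (f : X → ℕ) → ∑ (xs ++ ys) f ≡ ∑ xs f + ∑ ys f
    ∑-++ xs ys f = trans (cong sum (map-++ f xs ys)) (sum-++ (map f xs) (map f ys))

    ∑-1 : ∀ (xs : List X) → ∑[ x ∈ xs ] 1 ≡ length xs
    ∑-1 []       = refl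
    ∑-1 (x ∷ xs) = cong suc (∑-1 xs)

  ∑-map : ∀ {X Y : Set} (g : X → Y) (xs : List X) (f : Y → ℕ) → ∑ (map g xs) f ≡ ∑[ x ∈ xs ] f (g x)
  ∑-map g xs f = cong sum (sym (map-∘ xs))

  ∑-comm : ∀ {X Y : Set} (xs : List X) (ys : List Y) (f : X → Y → ℕ) →
           ∑[ x ∈ xs ] ∑[ y ∈ ys ] f x y ≡ ∑[ y ∈ ys ] ∑[ x ∈ xs ] f x y
  ∑-comm []       ys f = sym (∑-zero ys (λ _ → refl))
  ∑-comm (x ∷ xs) ys f = trans (cong (∑ ys (f x) +_) (∑-comm xs ys f)) (sym (∑-+ ys (f x) _))

  ∑-*-∑-comm : ∀ {X Y : Set} (xs : List X) (ys : List Y) (a : X → ℕ) (b : Y → ℕ) (c : X → Y → ℕ) →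
               ∑[ x ∈ xs ] (a x * ∑[ y ∈ ys ] (b y * c x y)) ≡ ∑[ y ∈ ys ] (b y * ∑[ x ∈ xs ] (a x * c x y))
  ∑-*-∑-comm xs ys a b c = begin
    ∑[ x ∈ xs ] (a x * ∑[ y ∈ ys ] (b y * c x y))
      ≡⟨ ∑-cong xs (λ x → ∑-*ˡ ys (a x) _) ⟨
    ∑[ x ∈ xs ] ∑[ y ∈ ys ] (a x * (b y * c x y))
      ≡⟨ ∑-comm xs ys _ ⟩
    ∑[ y ∈ ys ] ∑[ x ∈ xs ] (a x * (b y * c x y))
      ≡⟨ ∑-cong ys (λ y → ∑-cong xs (λ x → x∙yz≈y∙xz (a x) (b y) (c x y))) ⟩
    ∑[ y ∈ ys ] ∑[ x ∈ xs ] (b y * (a x * c x y))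
      ≡⟨ ∑-cong ys (λ y → ∑-*ˡ xs (b y) _) ⟩
    ∑[ y ∈ ys ] (b y * ∑[ x ∈ xs ] (a x * c x y)) ∎
    where open ≡-Reasoning

  𝟙 : {P : Set} → Dec P → ℕ
  𝟙 (yes _) = 1
  𝟙 (no _)  = 0

  module _ {P : Set} where

    𝟙-yes : P → (p : Dec P) → 𝟙 p ≡ 1
    𝟙-yes x (yes _) = refl
    𝟙-yes x (no ¬x) = contradiction x ¬x

    𝟙-no : ¬ P → (p : Dec P) → 𝟙 p ≡ 0
    𝟙-no ¬x (yes x) = contradiction x ¬x
    𝟙-no ¬x (no _)  = refl

  module _ {P Q : Set} where

    𝟙-⇔ : (P → Q) → (Q → P) → (p : Dec P) (q : Dec Q) → 𝟙 p ≡ 𝟙 q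
    𝟙-⇔ to from p (yes y) = 𝟙-yes (from y) p
    𝟙-⇔ to from p (no ¬y) = 𝟙-no (¬y ∘ to) p

    𝟙-× : (p : Dec P) (q : Dec Q) → 𝟙 (p ×-dec q) ≡ 𝟙 p * 𝟙 q
    𝟙-× (yes _) (yes _) = refl
    𝟙-× (yes _) (no _)  = refl
    𝟙-× (no _)  _       = refl

  length-filter : ∀ {X : Set} {P : X → Set} (P? : ∀ x → Dec (P x)) (xs : List X) →
                  length (filter P? xs) ≡ ∑[ x ∈ xs ] 𝟙 (P? x)
  length-filter P? []       = refl
  length-filter P? (x ∷ xs) with P? x
  ... | yes _ = cong suc (length-filter P? xs)
  ... | no  _ = length-filter P? xs

  module _ {X : Set} {x : X} (_≟x : ∀ a → Dec (a ≡ x)) (g : X → ℕ) where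

    ∑-δ-∉ : ∀ {xs} → x ∉ xs → ∑[ a ∈ xs ] (𝟙 (a ≟x) * g a) ≡ 0
    ∑-δ-∉ {[]}     _    = refl
    ∑-δ-∉ {y ∷ xs} x∉xs =
      cong₂ _+_ (cong (_* g y) (𝟙-no (λ y≡x → x∉xs (here (sym y≡x))) (y ≟x))) (∑-δ-∉ (x∉xs ∘ there))

    ∑-δ : ∀ {xs} → Unique xs → x ∈ xs → ∑[ a ∈ xs ] (𝟙 (a ≟x) * g a) ≡ g x
    ∑-δ {y ∷ xs} (y∉xs ∷ _) (here refl) = begin
      𝟙 (y ≟x) * g y + ∑[ a ∈ xs ] (𝟙 (a ≟x) * g a)
        ≡⟨ cong₂ _+_ (cong (_* g y) (𝟙-yes refl (y ≟x))) (∑-δ-∉ (All¬⇒¬Any y∉xs)) ⟩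
      1 * g y + 0
        ≡⟨ +-identityʳ (g y + 0) ⟩
      g y + 0
        ≡⟨ +-identityʳ (g y) ⟩
      g y ∎
      where open ≡-Reasoning
    ∑-δ {y ∷ xs} (y∉xs ∷ xs-unique) (there x∈xs) =
      cong₂ _+_ (cong (_* g y) (𝟙-no (λ { refl → All¬⇒¬Any y∉xs x∈xs }) (y ≟x))) (∑-δ xs-unique x∈xs)

  𝟙-subst : ∀ {X : Set} {a b : X} (f : X → ℕ) (a≟b : Dec (a ≡ b)) → 𝟙 a≟b * f a ≡ 𝟙 a≟b * f b
  𝟙-subst f (yes refl) = refl
  𝟙-subst f (no _)     = refl

open Sums

allSubsets : ∀ n → List (Subset n)
allSubsets zero    = [] ∷ []
allSubsets (suc n) = map (inside ∷_) (allSubsets n) ++ map (outside ∷_) (allSubsets n)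

∑-allSubsets-∷ : ∀ n (f : Subset (suc n) → ℕ) →
                 ∑ (allSubsets (suc n)) f
                   ≡ ∑[ p ∈ allSubsets n ] f (inside ∷ p) ℕ.+ ∑[ p ∈ allSubsets n ] f (outside ∷ p)
∑-allSubsets-∷ n f = trans (∑-++ (map (inside ∷_) (allSubsets n)) _ f)
                           (cong₂ ℕ._+_ (∑-map _ (allSubsets n) f) (∑-map _ (allSubsets n) f))

∑-allSubsets-∁ : ∀ n (f : Subset n → ℕ) → ∑[ p ∈ allSubsets n ] f (∁ p) ≡ ∑ (allSubsets n) f
∑-allSubsets-∁ zero    f = refl
∑-allSubsets-∁ (suc n) f = begin
  ∑[ p ∈ allSubsets (suc n) ] f (∁ p)
    ≡⟨ ∑-allSubsets-∷ n _ ⟩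
  ∑[ p ∈ allSubsets n ] f (outside ∷ ∁ p) ℕ.+ ∑[ p ∈ allSubsets n ] f (inside ∷ ∁ p)
    ≡⟨ cong₂ ℕ._+_ (∑-allSubsets-∁ n _) (∑-allSubsets-∁ n _) ⟩
  ∑[ p ∈ allSubsets n ] f (outside ∷ p) ℕ.+ ∑[ p ∈ allSubsets n ] f (inside ∷ p)
    ≡⟨ ℕₚ.+-comm (∑[ p ∈ allSubsets n ] f (outside ∷ p)) _ ⟩
  ∑[ p ∈ allSubsets n ] f (inside ∷ p) ℕ.+ ∑[ p ∈ allSubsets n ] f (outside ∷ p)
    ≡⟨ ∑-allSubsets-∷ n f ⟨
  ∑ (allSubsets (suc n)) f ∎
  where open ≡-Reasoning

square-injective : ∀ {m n} → m ℕ.* m ≡ n ℕ.* n → m ≡ n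
square-injective {m} {n} eq with ℕₚ.<-cmp m n
... | tri< m<n _ _ = contradiction eq (ℕₚ.<⇒≢ (ℕₚ.*-mono-< m<n m<n))
... | tri≈ _ m≡n _ = m≡n
... | tri> _ _ n<m = contradiction (sym eq) (ℕₚ.<⇒≢ (ℕₚ.*-mono-< n<m n<m))

module Codes (F : FiniteField) where
  open FiniteField F

  commutativeRing : CommutativeRing 0ℓ 0ℓ
  commutativeRing = record { isCommutativeRing = isCommutativeRing }

  open CommutativeRing commutativeRing
    using (_-_; +-identityˡ; -‿inverseˡ; -‿inverseʳ; *-assoc; *-identityʳ; zeroˡ; zeroʳ; distribˡ)
  open RingProperties (CommutativeRing.ring commutativeRing)
    using (-1*x≈-x; -‿distribˡ-*; -‿involutive; +-inverseˡ-unique; //-rightDividesˡ; //-rightDividesʳ)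

  open CommutativeSemigroupProperties (CommutativeRing.+-commutativeSemigroup commutativeRing)
    using () renaming (interchange to +-interchange)
  open CommutativeSemigroupProperties (CommutativeRing.*-commutativeSemigroup commutativeRing)
    using () renaming (x∙yz≈y∙xz to *-x∙yz≈y∙xz; xy∙z≈zy∙x to *-xy∙z≈zy∙x;
                       xy∙z≈xz∙y to *-xy∙z≈xz∙y)

  x+-1x≡0 : ∀ x → x + - 1# * x ≡ 0#
  x+-1x≡0 x = trans (cong (x +_) (-1*x≈-x x)) (-‿inverseʳ x)

  [x+-1y]+y≡x : ∀ x y → (x + - 1# * y) + y ≡ x
  [x+-1y]+y≡x x y = trans (cong (λ z → x + z + y) (-1*x≈-x y)) (//-rightDividesˡ y x)

  0*x+y≡y : ∀ x y → 0# * x + y ≡ y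
  0*x+y≡y x y = trans (cong (_+ y) (zeroˡ x)) (+-identityˡ y)

  x*0+y≡y : ∀ x y → x * 0# + y ≡ y
  x*0+y≡y x y = trans (cong (_+ y) (zeroʳ x)) (+-identityˡ y)

  -x*y*z≡-[z*y*x] : ∀ x y z → - x * y * z ≡ - (z * y * x)
  -x*y*z≡-[z*y*x] x y z = begin
    - x * y * z      ≡⟨ cong (_* z) (-‿distribˡ-* x y) ⟨
    - (x * y) * z    ≡⟨ -‿distribˡ-* (x * y) z ⟨
    - (x * y * z)    ≡⟨ cong -_ (*-xy∙z≈zy∙x x y z) ⟩
    - (z * y * x)    ∎
    where open ≡-Reasoning

  ∑-elements-δ : ∀ x (g : Carrier → ℕ) → ∑[ a ∈ elements ] (𝟙 (a ≟ x) ℕ.* g a) ≡ g x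
  ∑-elements-δ x g = ∑-δ (_≟ x) g unique (complete x)

  ∑-elements-bijection : ∀ (g h : Carrier → Carrier) → (∀ y → g (h y) ≡ y) → (∀ a → h (g a) ≡ a) →
                         ∀ f → ∑[ a ∈ elements ] f (g a) ≡ ∑ elements f
  ∑-elements-bijection g h gh≗id hg≗id f = begin
    ∑[ a ∈ elements ] f (g a)
      ≡⟨ ∑-cong elements (λ a → ∑-elements-δ (g a) f) ⟨
    ∑[ a ∈ elements ] ∑[ y ∈ elements ] (𝟙 (y ≟ g a) ℕ.* f y)
      ≡⟨ ∑-comm elements elements _ ⟩
    ∑[ y ∈ elements ] ∑[ a ∈ elements ] (𝟙 (y ≟ g a) ℕ.* f y)
      ≡⟨ ∑-cong elements (λ y → ∑-cong elements (λ a →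
          cong (ℕ._* f y) (𝟙-⇔ (y≡ga⇒a≡hy a y) (a≡hy⇒y≡ga a y) (y ≟ g a) (a ≟ h y)))) ⟩
    ∑[ y ∈ elements ] ∑[ a ∈ elements ] (𝟙 (a ≟ h y) ℕ.* f y)
      ≡⟨ ∑-cong elements (λ y → ∑-elements-δ (h y) (λ _ → f y)) ⟩
    ∑ elements f ∎
    where
    open ≡-Reasoning
    y≡ga⇒a≡hy : ∀ a y → y ≡ g a → a ≡ h y
    y≡ga⇒a≡hy a y refl = sym (hg≗id a)
    a≡hy⇒y≡ga : ∀ a y → a ≡ h y → y ≡ g a
    a≡hy⇒y≡ga a y refl = sym (gh≗id y)

  ∑-elements-+ : ∀ c f → ∑[ a ∈ elements ] f (a + c) ≡ ∑ elements f
  ∑-elements-+ c = ∑-elements-bijection (_+ c) (_- c) (//-rightDividesˡ c) (//-rightDividesʳ c)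

  infixl 6 _⊕_
  infixr 7 _·_

  _⊕_ : ∀ {n} → Vec Carrier n → Vec Carrier n → Vec Carrier n
  _⊕_ = zipWith _+_

  _·_ : ∀ {n} → Carrier → Vec Carrier n → Vec Carrier n
  s · v = Vec.map (s *_) v

  zeros-⊕ : ∀ {n} (v : Vec Carrier n) → zeros F ⊕ v ≡ v
  zeros-⊕ = zipWith-identityˡ +-identityˡ

  v⊕-1·v≡zeros : ∀ {n} (v : Vec Carrier n) → v ⊕ - 1# · v ≡ zeros F
  v⊕-1·v≡zeros = zipWith-inverseʳ x+-1x≡0

  [v⊕-1·w]⊕w≡v : ∀ {n} (v w : Vec Carrier n) → (v ⊕ - 1# · w) ⊕ w ≡ v
  [v⊕-1·w]⊕w≡v []      []      = refl
  [v⊕-1·w]⊕w≡v (x ∷ v) (y ∷ w) = cong₂ _∷_ ([x+-1y]+y≡x x y) ([v⊕-1·w]⊕w≡v v w)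

  dot-⊕ʳ : ∀ {n} (u v w : Vec Carrier n) → dot F u (v ⊕ w) ≡ dot F u v + dot F u w
  dot-⊕ʳ []      []      []      = sym (+-identityˡ 0#)
  dot-⊕ʳ (a ∷ u) (b ∷ v) (c ∷ w) = begin
    a * (b + c) + dot F u (v ⊕ w)              ≡⟨ cong₂ _+_ (distribˡ a b c) (dot-⊕ʳ u v w) ⟩
    (a * b + a * c) + (dot F u v + dot F u w)  ≡⟨ +-interchange (a * b) (a * c) _ _ ⟩
    (a * b + dot F u v) + (a * c + dot F u w)  ∎
    where open ≡-Reasoning

  dot-·ʳ : ∀ {n} (u v : Vec Carrier n) s → dot F u (s · v) ≡ s * dot F u v
  dot-·ʳ []      []      s = sym (zeroʳ s)
  dot-·ʳ (a ∷ u) (b ∷ v) s = begin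
    a * (s * b) + dot F u (s · v)  ≡⟨ cong₂ _+_ (*-x∙yz≈y∙xz a s b) (dot-·ʳ u v s) ⟩
    s * (a * b) + s * dot F u v    ≡⟨ distribˡ s (a * b) (dot F u v) ⟨
    s * (a * b + dot F u v)        ∎
    where open ≡-Reasoning

  dot-difference : ∀ {n} (u v w : Vec Carrier n) → dot F u (v ⊕ - 1# · w) ≡ dot F u v + - 1# * dot F u w
  dot-difference u v w = trans (dot-⊕ʳ u v _) (cong (dot F u v +_) (dot-·ʳ u w (- 1#)))

  ∈-allVecs : ∀ {n} (v : Vec Carrier n) → v ∈ allVecs F n
  ∈-allVecs []      = here refl
  ∈-allVecs (x ∷ v) = ∈-cartesianProductWith⁺ _∷_ (complete x) (∈-allVecs v)

  ∑-cartesianProduct-∷ : ∀ {n} (xs : List Carrier) (vs : List (Vec Carrier n)) (f : Vec Carrier (suc n) → ℕ) →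
                         ∑ (cartesianProductWith _∷_ xs vs) f ≡ ∑[ a ∈ xs ] ∑[ w ∈ vs ] f (a ∷ w)
  ∑-cartesianProduct-∷ []       vs f = refl
  ∑-cartesianProduct-∷ (x ∷ xs) vs f =
    trans (∑-++ (map (x ∷_) vs) _ f) (cong₂ ℕ._+_ (∑-map (x ∷_) vs f) (∑-cartesianProduct-∷ xs vs f))

  ∑-allVecs-∷ : ∀ n (f : Vec Carrier (suc n) → ℕ) →
                ∑ (allVecs F (suc n)) f ≡ ∑[ a ∈ elements ] ∑[ w ∈ allVecs F n ] f (a ∷ w)
  ∑-allVecs-∷ n = ∑-cartesianProduct-∷ elements (allVecs F n)

  ∑-allVecs-⊕ : ∀ n (f : Vec Carrier n → ℕ) (x : Vec Carrier n) →
                ∑[ v ∈ allVecs F n ] f (v ⊕ x) ≡ ∑ (allVecs F n) f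
  ∑-allVecs-⊕ zero    f []       = refl
  ∑-allVecs-⊕ (suc n) f (c ∷ x) = begin
    ∑[ v ∈ allVecs F (suc n) ] f (v ⊕ (c ∷ x))
      ≡⟨ ∑-allVecs-∷ n _ ⟩
    ∑[ a ∈ elements ] ∑[ w ∈ allVecs F n ] f ((a + c) ∷ (w ⊕ x))
      ≡⟨ ∑-cong elements (λ a → ∑-allVecs-⊕ n (λ w → f ((a + c) ∷ w)) x) ⟩
    ∑[ a ∈ elements ] ∑[ w ∈ allVecs F n ] f ((a + c) ∷ w)
      ≡⟨ ∑-elements-+ c (λ a → ∑[ w ∈ allVecs F n ] f (a ∷ w)) ⟩
    ∑[ a ∈ elements ] ∑[ w ∈ allVecs F n ] f (a ∷ w)
      ≡⟨ ∑-allVecs-∷ n f ⟨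
    ∑ (allVecs F (suc n)) f ∎
    where open ≡-Reasoning

  infix 4 _∈ᶜ_ _∈ᶜ?_

  _∈ᶜ_ : ∀ {n} → Vec Carrier n → LinearCode F n → Set
  v ∈ᶜ 𝒞 = LinearCode._∈C 𝒞 v

  _∈ᶜ?_ : ∀ {n} (v : Vec Carrier n) (𝒞 : LinearCode F n) → Dec (v ∈ᶜ 𝒞)
  v ∈ᶜ? 𝒞 = LinearCode._∈C? 𝒞 v

  ∈ᶜ-difference : ∀ {n} (𝒞 : LinearCode F n) {u v} → u ∈ᶜ 𝒞 → v ∈ᶜ 𝒞 → u ⊕ - 1# · v ∈ᶜ 𝒞
  ∈ᶜ-difference 𝒞 {u} {v} u∈𝒞 v∈𝒞 =
    LinearCode.+-closed 𝒞 u _ u∈𝒞 (LinearCode.scale-closed 𝒞 (- 1#) v v∈𝒞)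

  InDual : ∀ {n} → LinearCode F n → Vec Carrier n → Set
  InDual 𝒞 u = ∀ c → c ∈ᶜ 𝒞 → dot F u c ≡ 0#

  inDual? : ∀ {n} (𝒞 : LinearCode F n) u → Dec (InDual 𝒞 u)
  inDual? {n} 𝒞 u = map′ (λ u⊥all c c∈𝒞 → All.lookup u⊥all (∈-allVecs c) c∈𝒞)
                         (λ u⊥𝒞 → All.tabulate (λ {c} _ → u⊥𝒞 c))
                         (all? (λ c → c ∈ᶜ? 𝒞 →-dec (dot F u c ≟ 0#)) (allVecs F n))

  ZeroOn : ∀ {n} → Subset n → Vec Carrier n → Set
  ZeroOn []            []      = ⊤
  ZeroOn (inside  ∷ p) (x ∷ v) = x ≡ 0# × ZeroOn p v
  ZeroOn (outside ∷ p) (x ∷ v) = ZeroOn p v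

  zeroOn? : ∀ {n} (p : Subset n) (v : Vec Carrier n) → Dec (ZeroOn p v)
  zeroOn? []            []      = yes tt
  zeroOn? (inside  ∷ p) (x ∷ v) = (x ≟ 0#) ×-dec zeroOn? p v
  zeroOn? (outside ∷ p) (x ∷ v) = zeroOn? p v

  ∑-zeroOn-inside : ∀ {n} (p : Subset n) (f : Vec Carrier (suc n) → ℕ) →
                    ∑[ v ∈ allVecs F (suc n) ] (f v ℕ.* 𝟙 (zeroOn? (inside ∷ p) v))
                      ≡ ∑[ w ∈ allVecs F n ] (f (0# ∷ w) ℕ.* 𝟙 (zeroOn? p w))
  ∑-zeroOn-inside {n} p f = begin
    ∑[ v ∈ allVecs F (suc n) ] (f v ℕ.* 𝟙 (zeroOn? (inside ∷ p) v))
      ≡⟨ ∑-allVecs-∷ n _ ⟩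
    ∑[ a ∈ elements ] ∑[ w ∈ allVecs F n ] (f (a ∷ w) ℕ.* 𝟙 ((a ≟ 0#) ×-dec zeroOn? p w))
      ≡⟨ ∑-cong elements (λ a →
          ∑-cong (allVecs F n) (λ w → pull-𝟙≟0 a w)) ⟩
    ∑[ a ∈ elements ] ∑[ w ∈ allVecs F n ] (𝟙 (a ≟ 0#) ℕ.* (f (a ∷ w) ℕ.* 𝟙 (zeroOn? p w)))
      ≡⟨ ∑-cong elements (λ a → ∑-*ˡ (allVecs F n) (𝟙 (a ≟ 0#)) _) ⟩
    ∑[ a ∈ elements ] (𝟙 (a ≟ 0#) ℕ.* ∑[ w ∈ allVecs F n ] (f (a ∷ w) ℕ.* 𝟙 (zeroOn? p w)))
      ≡⟨ ∑-elements-δ 0# _ ⟩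
    ∑[ w ∈ allVecs F n ] (f (0# ∷ w) ℕ.* 𝟙 (zeroOn? p w)) ∎
    where
    open ≡-Reasoning
    pull-𝟙≟0 : ∀ a w → f (a ∷ w) ℕ.* 𝟙 ((a ≟ 0#) ×-dec zeroOn? p w)
                       ≡ 𝟙 (a ≟ 0#) ℕ.* (f (a ∷ w) ℕ.* 𝟙 (zeroOn? p w))
    pull-𝟙≟0 a w = trans (cong (f (a ∷ w) ℕ.*_) (𝟙-× (a ≟ 0#) (zeroOn? p w)))
                         (ℕ*.x∙yz≈y∙xz (f (a ∷ w)) (𝟙 (a ≟ 0#)) (𝟙 (zeroOn? p w)))

  module _ {n} (𝒞 : LinearCode F n) where

    #code : ℕ
    #code = ∑[ v ∈ allVecs F n ] 𝟙 (v ∈ᶜ? 𝒞)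

    #vanishingOn : Subset n → ℕ
    #vanishingOn p = ∑[ v ∈ allVecs F n ] (𝟙 (v ∈ᶜ? 𝒞) ℕ.* 𝟙 (zeroOn? p v))

    #dualSupportedIn : Subset n → ℕ
    #dualSupportedIn p = ∑[ u ∈ allVecs F n ] (𝟙 (inDual? 𝒞 u) ℕ.* 𝟙 (zeroOn? (∁ p) u))

  -- Puncturing and shortening at the first coordinate

  module _ {n} (𝒞 : LinearCode F (suc n)) where
    open LinearCode 𝒞

    shorten : LinearCode F n
    shorten = record
      { _∈C          = λ w → (0# ∷ w) ∈ᶜ 𝒞
      ; _∈C?         = λ w → (0# ∷ w) ∈ᶜ? 𝒞
      ; zero-mem     = zero-mem
      ; +-closed     = λ u v u∈ v∈ → subst (λ x → (x ∷ u ⊕ v) ∈ᶜ 𝒞) (+-identityˡ 0#) (+-closed _ _ u∈ v∈)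
      ; scale-closed = λ s v v∈ → subst (λ x → (x ∷ s · v) ∈ᶜ 𝒞) (zeroʳ s) (scale-closed s _ v∈)
      }

    puncture : LinearCode F n
    puncture = record
      { _∈C          = λ w → ∃[ a ] (a ∷ w) ∈ᶜ 𝒞
      ; _∈C?         = λ w → map′ Any.satisfied (λ (a , a∷w∈𝒞) → lose (complete a) a∷w∈𝒞)
                                  (any? (λ a → (a ∷ w) ∈ᶜ? 𝒞) elements)
      ; zero-mem     = 0# , zero-mem
      ; +-closed     = λ { u v (a , a∷u∈) (b , b∷v∈) → a + b , +-closed _ _ a∷u∈ b∷v∈ }
      ; scale-closed = λ { s v (a , a∷v∈) → s * a , scale-closed s _ a∷v∈ }
      }

    #kerPuncture : ℕ
    #kerPuncture = ∑[ a ∈ elements ] 𝟙 ((a ∷ zeros F) ∈ᶜ? 𝒞)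

    fiber-puncture : ∀ w → ∑[ a ∈ elements ] 𝟙 ((a ∷ w) ∈ᶜ? 𝒞) ≡ 𝟙 (w ∈ᶜ? puncture) ℕ.* #kerPuncture
    fiber-puncture w with w ∈ᶜ? puncture
    ... | no w∉ = ∑-zero elements (λ a → 𝟙-no (λ a∷w∈ → w∉ (a , a∷w∈)) ((a ∷ w) ∈ᶜ? 𝒞))
    ... | yes (a₀ , a₀∷w∈) = begin
      ∑[ a ∈ elements ] 𝟙 ((a ∷ w) ∈ᶜ? 𝒞)
        ≡⟨ ∑-cong elements (λ a → 𝟙-⇔ (to a) (from a) _ _) ⟩
      ∑[ a ∈ elements ] 𝟙 ((a + - 1# * a₀ ∷ zeros F) ∈ᶜ? 𝒞)
        ≡⟨ ∑-elements-+ (- 1# * a₀) (λ a → 𝟙 ((a ∷ zeros F) ∈ᶜ? 𝒞)) ⟩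
      #kerPuncture
        ≡⟨ ℕₚ.*-identityˡ _ ⟨
      1 ℕ.* #kerPuncture ∎
      where
      open ≡-Reasoning
      to : ∀ a → (a ∷ w) ∈ᶜ 𝒞 → (a + - 1# * a₀ ∷ zeros F) ∈ᶜ 𝒞
      to a a∷w∈ = subst (λ v → (a + - 1# * a₀ ∷ v) ∈ᶜ 𝒞) (v⊕-1·v≡zeros w) (∈ᶜ-difference 𝒞 a∷w∈ a₀∷w∈)
      from : ∀ a → (a + - 1# * a₀ ∷ zeros F) ∈ᶜ 𝒞 → (a ∷ w) ∈ᶜ 𝒞
      from a d∈ = subst (_∈ᶜ 𝒞) (cong₂ _∷_ ([x+-1y]+y≡x a a₀) (zeros-⊕ w)) (+-closed _ _ d∈ a₀∷w∈)

    ∑-puncture : ∀ (h : Vec Carrier n → ℕ) →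
                 ∑[ v ∈ allVecs F (suc n) ] (𝟙 (v ∈ᶜ? 𝒞) ℕ.* h (Vec.tail v))
                   ≡ #kerPuncture ℕ.* ∑[ w ∈ allVecs F n ] (𝟙 (w ∈ᶜ? puncture) ℕ.* h w)
    ∑-puncture h = begin
      ∑[ v ∈ allVecs F (suc n) ] (𝟙 (v ∈ᶜ? 𝒞) ℕ.* h (Vec.tail v))
        ≡⟨ ∑-allVecs-∷ n _ ⟩
      ∑[ a ∈ elements ] ∑[ w ∈ allVecs F n ] (𝟙 ((a ∷ w) ∈ᶜ? 𝒞) ℕ.* h w)
        ≡⟨ ∑-comm elements (allVecs F n) _ ⟩
      ∑[ w ∈ allVecs F n ] ∑[ a ∈ elements ] (𝟙 ((a ∷ w) ∈ᶜ? 𝒞) ℕ.* h w)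
        ≡⟨ ∑-cong (allVecs F n) (λ w → ∑-*ʳ elements (h w) _) ⟩
      ∑[ w ∈ allVecs F n ] (∑[ a ∈ elements ] 𝟙 ((a ∷ w) ∈ᶜ? 𝒞) ℕ.* h w)
        ≡⟨ ∑-cong (allVecs F n) (λ w → cong (ℕ._* h w) (fiber-puncture w)) ⟩
      ∑[ w ∈ allVecs F n ] (𝟙 (w ∈ᶜ? puncture) ℕ.* #kerPuncture ℕ.* h w)
        ≡⟨ ∑-cong (allVecs F n) (λ w → ℕ*.xy∙z≈y∙xz (𝟙 (w ∈ᶜ? puncture)) #kerPuncture (h w)) ⟩
      ∑[ w ∈ allVecs F n ] (#kerPuncture ℕ.* (𝟙 (w ∈ᶜ? puncture) ℕ.* h w))
        ≡⟨ ∑-*ˡ (allVecs F n) #kerPuncture _ ⟩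
      #kerPuncture ℕ.* ∑[ w ∈ allVecs F n ] (𝟙 (w ∈ᶜ? puncture) ℕ.* h w) ∎
      where open ≡-Reasoning

    #code-puncture : #code 𝒞 ≡ #kerPuncture ℕ.* #code puncture
    #code-puncture = begin
      #code 𝒞
        ≡⟨ ∑-cong (allVecs F (suc n)) (λ v → ℕₚ.*-identityʳ _) ⟨
      ∑[ v ∈ allVecs F (suc n) ] (𝟙 (v ∈ᶜ? 𝒞) ℕ.* 1)
        ≡⟨ ∑-puncture (λ _ → 1) ⟩
      #kerPuncture ℕ.* ∑[ w ∈ allVecs F n ] (𝟙 (w ∈ᶜ? puncture) ℕ.* 1)
        ≡⟨ cong (#kerPuncture ℕ.*_) (∑-cong (allVecs F n) (λ w → ℕₚ.*-identityʳ _)) ⟩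
      #kerPuncture ℕ.* #code puncture ∎
      where open ≡-Reasoning

    #vanishingOn-puncture : ∀ p → #vanishingOn 𝒞 (outside ∷ p) ≡ #kerPuncture ℕ.* #vanishingOn puncture p
    #vanishingOn-puncture p =
      trans (∑-cong (allVecs F (suc n)) λ { (a ∷ w) → refl }) (∑-puncture (λ w → 𝟙 (zeroOn? p w)))

    inDual-puncture⁺ : ∀ u → InDual 𝒞 (0# ∷ u) → InDual puncture u
    inDual-puncture⁺ u 0∷u⊥ w (a , a∷w∈) = trans (sym (0*x+y≡y a (dot F u w))) (0∷u⊥ (a ∷ w) a∷w∈)

    inDual-puncture⁻ : ∀ u → InDual puncture u → InDual 𝒞 (0# ∷ u)
    inDual-puncture⁻ u u⊥ (a ∷ w) a∷w∈ = trans (0*x+y≡y a (dot F u w)) (u⊥ w (a , a∷w∈))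

    #dualSupportedIn-puncture : ∀ p → #dualSupportedIn 𝒞 (outside ∷ p) ≡ #dualSupportedIn puncture p
    #dualSupportedIn-puncture p = trans (∑-zeroOn-inside (∁ p) (λ v → 𝟙 (inDual? 𝒞 v)))
      (∑-cong (allVecs F n) (λ u → cong (ℕ._* 𝟙 (zeroOn? (∁ p) u))
        (𝟙-⇔ (inDual-puncture⁺ u) (inDual-puncture⁻ u) (inDual? 𝒞 (0# ∷ u)) (inDual? puncture u))))

    #vanishingOn-shorten : ∀ p → #vanishingOn 𝒞 (inside ∷ p) ≡ #vanishingOn shorten p
    #vanishingOn-shorten p = ∑-zeroOn-inside p (λ v → 𝟙 (v ∈ᶜ? 𝒞))

    difference-∈shorten : ∀ {a v w} → (a ∷ v) ∈ᶜ 𝒞 → (a ∷ w) ∈ᶜ 𝒞 → v ⊕ - 1# · w ∈ᶜ shorten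
    difference-∈shorten {a} {v} {w} a∷v∈ a∷w∈ =
      subst (λ x → (x ∷ v ⊕ - 1# · w) ∈ᶜ 𝒞) (x+-1x≡0 a) (∈ᶜ-difference 𝒞 a∷v∈ a∷w∈)

    IsHead : Carrier → Set
    IsHead a = ∃[ w ] (a ∷ w) ∈ᶜ 𝒞

    isHead? : ∀ a → Dec (IsHead a)
    isHead? a = map′ Any.satisfied (λ (w , a∷w∈) → lose (∈-allVecs w) a∷w∈)
                     (any? (λ w → (a ∷ w) ∈ᶜ? 𝒞) (allVecs F n))

    #heads : ℕ
    #heads = ∑[ a ∈ elements ] 𝟙 (isHead? a)

    fiber-head : ∀ a → ∑[ w ∈ allVecs F n ] 𝟙 ((a ∷ w) ∈ᶜ? 𝒞) ≡ 𝟙 (isHead? a) ℕ.* #code shorten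
    fiber-head a with isHead? a
    ... | no ¬head = ∑-zero (allVecs F n) (λ w → 𝟙-no (λ a∷w∈ → ¬head (w , a∷w∈)) ((a ∷ w) ∈ᶜ? 𝒞))
    ... | yes (w₀ , a∷w₀∈) = begin
      ∑[ w ∈ allVecs F n ] 𝟙 ((a ∷ w) ∈ᶜ? 𝒞)
        ≡⟨ ∑-cong (allVecs F n) (λ w → 𝟙-⇔ (λ a∷w∈ → difference-∈shorten a∷w∈ a∷w₀∈) (from w) _ _) ⟩
      ∑[ w ∈ allVecs F n ] 𝟙 (w ⊕ - 1# · w₀ ∈ᶜ? shorten)
        ≡⟨ ∑-allVecs-⊕ n (λ v → 𝟙 (v ∈ᶜ? shorten)) (- 1# · w₀) ⟩
      #code shorten
        ≡⟨ ℕₚ.*-identityˡ _ ⟨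
      1 ℕ.* #code shorten ∎
      where
      open ≡-Reasoning
      from : ∀ w → w ⊕ - 1# · w₀ ∈ᶜ shorten → (a ∷ w) ∈ᶜ 𝒞
      from w d∈ = subst (_∈ᶜ 𝒞) (cong₂ _∷_ (+-identityˡ a) ([v⊕-1·w]⊕w≡v w w₀)) (+-closed _ _ d∈ a∷w₀∈)

    #code-shorten : #code 𝒞 ≡ #heads ℕ.* #code shorten
    #code-shorten = begin
      #code 𝒞                                                      ≡⟨ ∑-allVecs-∷ n _ ⟩
      ∑[ a ∈ elements ] ∑[ w ∈ allVecs F n ] 𝟙 ((a ∷ w) ∈ᶜ? 𝒞)     ≡⟨ ∑-cong elements fiber-head ⟩
      ∑[ a ∈ elements ] (𝟙 (isHead? a) ℕ.* #code shorten)          ≡⟨ ∑-*ʳ elements (#code shorten) _ ⟩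
      #heads ℕ.* #code shorten                                      ∎
      where open ≡-Reasoning

    #dualExtensions : Vec Carrier n → ℕ
    #dualExtensions u = ∑[ b ∈ elements ] 𝟙 (inDual? 𝒞 (b ∷ u))

    inDual-shorten : ∀ b u → InDual 𝒞 (b ∷ u) → InDual shorten u
    inDual-shorten b u b∷u⊥ w 0∷w∈ = trans (sym (x*0+y≡y b (dot F u w))) (b∷u⊥ (0# ∷ w) 0∷w∈)

    HeadsVanish : Set
    HeadsVanish = ∀ a w → (a ∷ w) ∈ᶜ 𝒞 → a ≡ 0#

    module _ (heads-vanish : HeadsVanish) where

      #heads-vanish : #heads ≡ 1
      #heads-vanish = begin
        ∑[ a ∈ elements ] 𝟙 (isHead? a)
          ≡⟨ ∑-cong elements (λ a → trans (𝟙-⇔ (isHead⇒≡0 a) (≡0⇒isHead a) _ (a ≟ 0#))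
                                           (sym (ℕₚ.*-identityʳ _))) ⟩
        ∑[ a ∈ elements ] (𝟙 (a ≟ 0#) ℕ.* 1)
          ≡⟨ ∑-elements-δ 0# (λ _ → 1) ⟩
        1 ∎
        where
        open ≡-Reasoning
        isHead⇒≡0 : ∀ a → IsHead a → a ≡ 0#
        isHead⇒≡0 a (w , a∷w∈) = heads-vanish a w a∷w∈
        ≡0⇒isHead : ∀ a → a ≡ 0# → IsHead a
        ≡0⇒isHead a refl = zeros F , zero-mem

      #dualExtensions-vanish : ∀ {u} → InDual shorten u → #dualExtensions u ≡ size
      #dualExtensions-vanish {u} u⊥ =
        trans (∑-cong elements (λ b → 𝟙-yes (b∷u⊥ b) (inDual? 𝒞 (b ∷ u)))) (∑-1 elements)
        where
        b∷u⊥ : ∀ b → InDual 𝒞 (b ∷ u)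
        b∷u⊥ b (a ∷ w) a∷w∈ with refl ← heads-vanish a w a∷w∈ = trans (x*0+y≡y b (dot F u w)) (u⊥ w a∷w∈)

    module _ {a₀ w₀} (a₀∷w₀∈ : (a₀ ∷ w₀) ∈ᶜ 𝒞) (a₀≢0 : ¬ a₀ ≡ 0#) where

      a₀⁻¹ : Carrier
      a₀⁻¹ = proj₁ (inverse a₀ a₀≢0)

      a*a₀*a₀⁻¹≡a : ∀ a → a * a₀ * a₀⁻¹ ≡ a
      a*a₀*a₀⁻¹≡a a =
        trans (*-assoc a a₀ a₀⁻¹) (trans (cong (a *_) (proj₂ (inverse a₀ a₀≢0))) (*-identityʳ a))

      a*a₀⁻¹*a₀≡a : ∀ a → a * a₀⁻¹ * a₀ ≡ a
      a*a₀⁻¹*a₀≡a a = trans (*-xy∙z≈xz∙y a a₀⁻¹ a₀) (a*a₀*a₀⁻¹≡a a)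

      scaled-∈ : ∀ a → (a ∷ (a * a₀⁻¹) · w₀) ∈ᶜ 𝒞
      scaled-∈ a =
        subst (λ x → (x ∷ (a * a₀⁻¹) · w₀) ∈ᶜ 𝒞) (a*a₀⁻¹*a₀≡a a) (scale-closed (a * a₀⁻¹) _ a₀∷w₀∈)

      #heads-nonvanish : #heads ≡ size
      #heads-nonvanish = trans (∑-cong elements (λ a → 𝟙-yes (_ , scaled-∈ a) (isHead? a))) (∑-1 elements)

      module _ {u} (u⊥ : InDual shorten u) where

        β : Carrier
        β = - dot F u w₀ * a₀⁻¹

        -- The tail of (a ∷ w) − a a₀⁻¹ (a₀ ∷ w₀) lies in the shortened code.
        dot-tail : ∀ a w → (a ∷ w) ∈ᶜ 𝒞 → dot F u w ≡ a * a₀⁻¹ * dot F u w₀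
        dot-tail a w a∷w∈ = begin
          dot F u w
            ≡⟨ +-inverseˡ-unique _ _ (trans (sym (dot-difference u w _))
                                            (u⊥ _ (difference-∈shorten a∷w∈ (scaled-∈ a)))) ⟩
          - (- 1# * dot F u (s · w₀))
            ≡⟨ cong -_ (-1*x≈-x _) ⟩
          - - dot F u (s · w₀)
            ≡⟨ -‿involutive _ ⟩
          dot F u (s · w₀)
            ≡⟨ dot-·ʳ u w₀ s ⟩
          s * dot F u w₀ ∎
          where
          open ≡-Reasoning
          s = a * a₀⁻¹

        inDual⇔≡β : ∀ b → InDual 𝒞 (b ∷ u) ⇔ b ≡ β
        inDual⇔≡β b = mk⇔ to from
          where
          to : InDual 𝒞 (b ∷ u) → b ≡ β
          to b∷u⊥ = trans (sym (a*a₀*a₀⁻¹≡a b)) (cong (_* a₀⁻¹) (+-inverseˡ-unique _ _ (b∷u⊥ _ a₀∷w₀∈)))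
          from : b ≡ β → InDual 𝒞 (b ∷ u)
          from refl (a ∷ w) a∷w∈ = begin
            β * a + dot F u w
              ≡⟨ cong₂ _+_ (-x*y*z≡-[z*y*x] (dot F u w₀) a₀⁻¹ a) (dot-tail a w a∷w∈) ⟩
            - (a * a₀⁻¹ * dot F u w₀) + a * a₀⁻¹ * dot F u w₀
              ≡⟨ -‿inverseˡ _ ⟩
            0# ∎
            where open ≡-Reasoning

        #dualExtensions-nonvanish : #dualExtensions u ≡ 1
        #dualExtensions-nonvanish = begin
          ∑[ b ∈ elements ] 𝟙 (inDual? 𝒞 (b ∷ u))
            ≡⟨ ∑-cong elements (λ b → trans (𝟙-⇔ (Equivalence.to (inDual⇔≡β b)) (Equivalence.from (inDual⇔≡β b))
                                                  (inDual? 𝒞 (b ∷ u)) (b ≟ β))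
                                             (sym (ℕₚ.*-identityʳ _))) ⟩
          ∑[ b ∈ elements ] (𝟙 (b ≟ β) ℕ.* 1)
            ≡⟨ ∑-elements-δ β (λ _ → 1) ⟩
          1 ∎
          where open ≡-Reasoning

    -- If some codeword has a nonzero first coordinate, every a ∈ F is a head and u has exactly
    -- one extension to the dual; otherwise 0 is the only head and every b ∷ u is in the dual.
    #dualExtensions-*-#heads : ∀ u → #dualExtensions u ℕ.* #heads ≡ size ℕ.* 𝟙 (inDual? shorten u)
    #dualExtensions-*-#heads u with inDual? shorten u
    ... | no u⊥̸ =
      trans (cong (ℕ._* #heads) (∑-zero elements (λ b → 𝟙-no (u⊥̸ ∘ inDual-shorten b u) (inDual? 𝒞 (b ∷ u)))))
            (sym (ℕₚ.*-zeroʳ size))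
    ... | yes u⊥ with any? (λ c → c ∈ᶜ? 𝒞 ×-dec ¬? (Vec.head c ≟ 0#)) (allVecs F (suc n))
    ...   | yes nonvanishing = nonvanish (Any.satisfied nonvanishing)
      where
      nonvanish : ∃[ c ] (c ∈ᶜ 𝒞 × ¬ Vec.head c ≡ 0#) → #dualExtensions u ℕ.* #heads ≡ size ℕ.* 1
      nonvanish ((a₀ ∷ w₀) , a₀∷w₀∈ , a₀≢0) =
        trans (cong₂ ℕ._*_ (#dualExtensions-nonvanish a₀∷w₀∈ a₀≢0 u⊥) (#heads-nonvanish a₀∷w₀∈ a₀≢0))
              (ℕₚ.*-comm 1 size)
    ...   | no ¬nonvanishing =
      cong₂ ℕ._*_ (#dualExtensions-vanish heads-vanish u⊥) (#heads-vanish heads-vanish)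
      where
      heads-vanish : HeadsVanish
      heads-vanish a w a∷w∈ =
        decidable-stable (a ≟ 0#) (λ a≢0 → ¬nonvanishing (lose (∈-allVecs (a ∷ w)) (a∷w∈ , a≢0)))

    #dualSupportedIn-shorten : ∀ p →
      #heads ℕ.* #dualSupportedIn 𝒞 (inside ∷ p) ≡ size ℕ.* #dualSupportedIn shorten p
    #dualSupportedIn-shorten p = begin
      #heads ℕ.* #dualSupportedIn 𝒞 (inside ∷ p)
        ≡⟨ cong (#heads ℕ.*_) (∑-allVecs-∷ n _) ⟩
      #heads ℕ.* ∑[ b ∈ elements ] ∑[ u ∈ allVecs F n ] (𝟙 (inDual? 𝒞 (b ∷ u)) ℕ.* Z u)
        ≡⟨ cong (#heads ℕ.*_) (∑-comm elements (allVecs F n) _) ⟩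
      #heads ℕ.* ∑[ u ∈ allVecs F n ] ∑[ b ∈ elements ] (𝟙 (inDual? 𝒞 (b ∷ u)) ℕ.* Z u)
        ≡⟨ cong (#heads ℕ.*_) (∑-cong (allVecs F n) (λ u → ∑-*ʳ elements (Z u) _)) ⟩
      #heads ℕ.* ∑[ u ∈ allVecs F n ] (#dualExtensions u ℕ.* Z u)
        ≡⟨ ∑-*ˡ (allVecs F n) #heads _ ⟨
      ∑[ u ∈ allVecs F n ] (#heads ℕ.* (#dualExtensions u ℕ.* Z u))
        ≡⟨ ∑-cong (allVecs F n) (λ u → reassociate u) ⟩
      ∑[ u ∈ allVecs F n ] (size ℕ.* (𝟙 (inDual? shorten u) ℕ.* Z u))
        ≡⟨ ∑-*ˡ (allVecs F n) size _ ⟩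
      size ℕ.* #dualSupportedIn shorten p ∎
      where
      open ≡-Reasoning
      Z : Vec Carrier n → ℕ
      Z u = 𝟙 (zeroOn? (∁ p) u)
      reassociate : ∀ u → #heads ℕ.* (#dualExtensions u ℕ.* Z u) ≡ size ℕ.* (𝟙 (inDual? shorten u) ℕ.* Z u)
      reassociate u = begin
        #heads ℕ.* (#dualExtensions u ℕ.* Z u)
          ≡⟨ ℕₚ.*-assoc #heads _ (Z u) ⟨
        #heads ℕ.* #dualExtensions u ℕ.* Z u
          ≡⟨ cong (ℕ._* Z u) (trans (ℕₚ.*-comm #heads _) (#dualExtensions-*-#heads u)) ⟩
        size ℕ.* 𝟙 (inDual? shorten u) ℕ.* Z u
          ≡⟨ ℕₚ.*-assoc size _ (Z u) ⟩
        size ℕ.* (𝟙 (inDual? shorten u) ℕ.* Z u) ∎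

  #vanishingOn-duality : ∀ {n} (𝒞 : LinearCode F n) (p : Subset n) →
                         #vanishingOn 𝒞 p ℕ.* size ℕ.^ ∣ p ∣ ≡ #code 𝒞 ℕ.* #dualSupportedIn 𝒞 p
  #vanishingOn-duality {zero} 𝒞 []
    rewrite 𝟙-yes (LinearCode.zero-mem 𝒞) ([] ∈ᶜ? 𝒞)
          | 𝟙-yes {InDual 𝒞 []} (λ { [] _ → refl }) (inDual? 𝒞 []) = refl
  #vanishingOn-duality {suc n} 𝒞 (outside ∷ p) = begin
    #vanishingOn 𝒞 (outside ∷ p) ℕ.* size ℕ.^ ∣ p ∣
      ≡⟨ cong (ℕ._* size ℕ.^ ∣ p ∣) (#vanishingOn-puncture 𝒞 p) ⟩
    #kerPuncture 𝒞 ℕ.* #vanishingOn P p ℕ.* size ℕ.^ ∣ p ∣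
      ≡⟨ ℕₚ.*-assoc (#kerPuncture 𝒞) _ _ ⟩
    #kerPuncture 𝒞 ℕ.* (#vanishingOn P p ℕ.* size ℕ.^ ∣ p ∣)
      ≡⟨ cong (#kerPuncture 𝒞 ℕ.*_) (#vanishingOn-duality P p) ⟩
    #kerPuncture 𝒞 ℕ.* (#code P ℕ.* #dualSupportedIn P p)
      ≡⟨ ℕₚ.*-assoc (#kerPuncture 𝒞) _ _ ⟨
    #kerPuncture 𝒞 ℕ.* #code P ℕ.* #dualSupportedIn P p
      ≡⟨ cong₂ ℕ._*_ (#code-puncture 𝒞) (#dualSupportedIn-puncture 𝒞 p) ⟨
    #code 𝒞 ℕ.* #dualSupportedIn 𝒞 (outside ∷ p) ∎
    where
    open ≡-Reasoning
    P = puncture 𝒞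
  #vanishingOn-duality {suc n} 𝒞 (inside ∷ p) = begin
    #vanishingOn 𝒞 (inside ∷ p) ℕ.* (size ℕ.* size ℕ.^ ∣ p ∣)
      ≡⟨ cong (ℕ._* (size ℕ.* size ℕ.^ ∣ p ∣)) (#vanishingOn-shorten 𝒞 p) ⟩
    #vanishingOn S p ℕ.* (size ℕ.* size ℕ.^ ∣ p ∣)
      ≡⟨ ℕ*.x∙yz≈y∙xz (#vanishingOn S p) size _ ⟩
    size ℕ.* (#vanishingOn S p ℕ.* size ℕ.^ ∣ p ∣)
      ≡⟨ cong (size ℕ.*_) (#vanishingOn-duality S p) ⟩
    size ℕ.* (#code S ℕ.* #dualSupportedIn S p)
      ≡⟨ ℕ*.x∙yz≈y∙xz size (#code S) _ ⟩
    #code S ℕ.* (size ℕ.* #dualSupportedIn S p)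
      ≡⟨ cong (#code S ℕ.*_) (#dualSupportedIn-shorten 𝒞 p) ⟨
    #code S ℕ.* (#heads 𝒞 ℕ.* #dualSupportedIn 𝒞 (inside ∷ p))
      ≡⟨ ℕ*.x∙yz≈y∙xz (#code S) (#heads 𝒞) _ ⟩
    #heads 𝒞 ℕ.* (#code S ℕ.* #dualSupportedIn 𝒞 (inside ∷ p))
      ≡⟨ ℕₚ.*-assoc (#heads 𝒞) _ _ ⟨
    #heads 𝒞 ℕ.* #code S ℕ.* #dualSupportedIn 𝒞 (inside ∷ p)
      ≡⟨ cong (ℕ._* #dualSupportedIn 𝒞 (inside ∷ p)) (#code-shorten 𝒞) ⟨
    #code 𝒞 ℕ.* #dualSupportedIn 𝒞 (inside ∷ p) ∎
    where
    open ≡-Reasoning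
    S = shorten 𝒞

  -- Binomial moments

  zeroCount : ∀ {n} → Vec Carrier n → ℕ
  zeroCount []      = 0
  zeroCount (x ∷ v) with x ≟ 0#
  ... | yes _ = suc (zeroCount v)
  ... | no  _ = zeroCount v

  zeroCount+weight : ∀ {n} (v : Vec Carrier n) → zeroCount v ℕ.+ weight F v ≡ n
  zeroCount+weight []      = refl
  zeroCount+weight (x ∷ v) with x ≟ 0#
  ... | yes _ = cong suc (zeroCount+weight v)
  ... | no  _ = trans (ℕₚ.+-suc (zeroCount v) (weight F v)) (cong suc (zeroCount+weight v))

  zeroCount≡n∸weight : ∀ {n} (v : Vec Carrier n) → zeroCount v ≡ n ℕ.∸ weight F v
  zeroCount≡n∸weight {n} v =
    trans (sym (ℕₚ.m+n∸n≡m (zeroCount v) (weight F v))) (cong (ℕ._∸ weight F v) (zeroCount+weight v))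

  ∑-subsets-zeroOn : ∀ {n} (v : Vec Carrier n) k →
                     ∑[ p ∈ allSubsets n ] (𝟙 (∣ p ∣ ℕ.≟ k) ℕ.* 𝟙 (zeroOn? p v)) ≡ zeroCount v C k
  ∑-subsets-zeroOn []      zero    = refl
  ∑-subsets-zeroOn []      (suc k) = refl
  ∑-subsets-zeroOn {suc n} (x ∷ v) k = begin
    ∑[ p ∈ allSubsets (suc n) ] (𝟙 (∣ p ∣ ℕ.≟ k) ℕ.* 𝟙 (zeroOn? p (x ∷ v)))
      ≡⟨ ∑-allSubsets-∷ n _ ⟩
    ∑[ p ∈ allSubsets n ] (𝟙 (suc ∣ p ∣ ℕ.≟ k) ℕ.* 𝟙 ((x ≟ 0#) ×-dec zeroOn? p v)) ℕ.+ rest k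
      ≡⟨ cong₂ ℕ._+_ (∑-cong (allSubsets n) pull-𝟙≟0) (∑-subsets-zeroOn v k) ⟩
    ∑[ p ∈ allSubsets n ] (𝟙 (x ≟ 0#) ℕ.* shifted k p) ℕ.+ zeroCount v C k
      ≡⟨ cong (ℕ._+ zeroCount v C k) (∑-*ˡ (allSubsets n) (𝟙 (x ≟ 0#)) (shifted k)) ⟩
    𝟙 (x ≟ 0#) ℕ.* ∑ (allSubsets n) (shifted k) ℕ.+ zeroCount v C k
      ≡⟨ pascal k ⟩
    zeroCount (x ∷ v) C k ∎
    where
    open ≡-Reasoning
    rest : ℕ → ℕ
    rest k = ∑[ p ∈ allSubsets n ] (𝟙 (∣ p ∣ ℕ.≟ k) ℕ.* 𝟙 (zeroOn? p v))
    shifted : ℕ → Subset n → ℕ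
    shifted k p = 𝟙 (suc ∣ p ∣ ℕ.≟ k) ℕ.* 𝟙 (zeroOn? p v)
    pull-𝟙≟0 : ∀ p → 𝟙 (suc ∣ p ∣ ℕ.≟ k) ℕ.* 𝟙 ((x ≟ 0#) ×-dec zeroOn? p v) ≡ 𝟙 (x ≟ 0#) ℕ.* shifted k p
    pull-𝟙≟0 p = trans (cong (𝟙 (suc ∣ p ∣ ℕ.≟ k) ℕ.*_) (𝟙-× (x ≟ 0#) (zeroOn? p v)))
                       (ℕ*.x∙yz≈y∙xz (𝟙 (suc ∣ p ∣ ℕ.≟ k)) (𝟙 (x ≟ 0#)) (𝟙 (zeroOn? p v)))
    pascal : ∀ k → 𝟙 (x ≟ 0#) ℕ.* ∑ (allSubsets n) (shifted k) ℕ.+ zeroCount v C k ≡ zeroCount (x ∷ v) C k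
    pascal k with x ≟ 0#
    ... | no  _ = refl
    pascal zero | yes _ = cong (ℕ._+ 1) (trans (ℕₚ.+-identityʳ _) (∑-zero (allSubsets n) (λ p →
      cong (ℕ._* 𝟙 (zeroOn? p v)) (𝟙-no (λ ()) (suc ∣ p ∣ ℕ.≟ 0)))))
    pascal (suc k) | yes _ = begin
      1 ℕ.* ∑ (allSubsets n) (shifted (suc k)) ℕ.+ zeroCount v C suc k
        ≡⟨ cong (ℕ._+ zeroCount v C suc k) (ℕₚ.*-identityˡ _) ⟩
      ∑ (allSubsets n) (shifted (suc k)) ℕ.+ zeroCount v C suc k
        ≡⟨ cong (ℕ._+ zeroCount v C suc k) (trans (∑-cong (allSubsets n) (λ p →
            cong (ℕ._* 𝟙 (zeroOn? p v)) (𝟙-⇔ ℕₚ.suc-injective (cong suc) (suc ∣ p ∣ ℕ.≟ suc k) (∣ p ∣ ℕ.≟ k))))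
            (∑-subsets-zeroOn v k)) ⟩
      zeroCount v C k ℕ.+ zeroCount v C suc k
        ≡⟨ nCk+nC[k+1]≡[n+1]C[k+1] (zeroCount v) k ⟩
      suc (zeroCount v) C suc k ∎

  module _ {n} (𝒞 : LinearCode F n) where

    ∑-#vanishingOn : ∀ k → ∑[ p ∈ allSubsets n ] (𝟙 (∣ p ∣ ℕ.≟ k) ℕ.* #vanishingOn 𝒞 p)
                           ≡ ∑[ v ∈ allVecs F n ] (𝟙 (v ∈ᶜ? 𝒞) ℕ.* ((n ℕ.∸ weight F v) C k))
    ∑-#vanishingOn k = trans
      (∑-*-∑-comm (allSubsets n) (allVecs F n) (λ p → 𝟙 (∣ p ∣ ℕ.≟ k)) (λ v → 𝟙 (v ∈ᶜ? 𝒞)) (λ p v → 𝟙 (zeroOn? p v)))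
      (∑-cong (allVecs F n) (λ v → cong (𝟙 (v ∈ᶜ? 𝒞) ℕ.*_)
        (trans (∑-subsets-zeroOn v k) (cong (_C k) (zeroCount≡n∸weight v)))))

    ∑-#dualSupportedIn : ∀ k → k ℕ.≤ n →
      ∑[ p ∈ allSubsets n ] (𝟙 (∣ p ∣ ℕ.≟ k) ℕ.* #dualSupportedIn 𝒞 p)
        ≡ ∑[ u ∈ allVecs F n ] (𝟙 (inDual? 𝒞 u) ℕ.* ((n ℕ.∸ weight F u) C (n ℕ.∸ k)))
    ∑-#dualSupportedIn k k≤n = trans
      (∑-*-∑-comm (allSubsets n) (allVecs F n) (λ p → 𝟙 (∣ p ∣ ℕ.≟ k)) (λ u → 𝟙 (inDual? 𝒞 u)) (λ p u → 𝟙 (zeroOn? (∁ p) u)))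
      (∑-cong (allVecs F n) (λ u → cong (𝟙 (inDual? 𝒞 u) ℕ.*_) (complements u)))
      where
      complements : ∀ u → ∑[ p ∈ allSubsets n ] (𝟙 (∣ p ∣ ℕ.≟ k) ℕ.* 𝟙 (zeroOn? (∁ p) u))
                            ≡ (n ℕ.∸ weight F u) C (n ℕ.∸ k)
      complements u = begin
        ∑[ p ∈ allSubsets n ] (𝟙 (∣ p ∣ ℕ.≟ k) ℕ.* 𝟙 (zeroOn? (∁ p) u))
          ≡⟨ ∑-cong (allSubsets n) (λ p → cong (ℕ._* 𝟙 (zeroOn? (∁ p) u))
              (𝟙-⇔ (size≡k⇒∁size≡n∸k p) (∁size≡n∸k⇒size≡k p) (∣ p ∣ ℕ.≟ k) (∣ ∁ p ∣ ℕ.≟ n ℕ.∸ k))) ⟩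
        ∑[ p ∈ allSubsets n ] (𝟙 (∣ ∁ p ∣ ℕ.≟ n ℕ.∸ k) ℕ.* 𝟙 (zeroOn? (∁ p) u))
          ≡⟨ ∑-allSubsets-∁ n (λ q → 𝟙 (∣ q ∣ ℕ.≟ n ℕ.∸ k) ℕ.* 𝟙 (zeroOn? q u)) ⟩
        ∑[ q ∈ allSubsets n ] (𝟙 (∣ q ∣ ℕ.≟ n ℕ.∸ k) ℕ.* 𝟙 (zeroOn? q u))
          ≡⟨ ∑-subsets-zeroOn u (n ℕ.∸ k) ⟩
        zeroCount u C (n ℕ.∸ k)
          ≡⟨ cong (_C (n ℕ.∸ k)) (zeroCount≡n∸weight u) ⟩
        (n ℕ.∸ weight F u) C (n ℕ.∸ k) ∎
        where
        open ≡-Reasoning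
        size≡k⇒∁size≡n∸k : ∀ p → ∣ p ∣ ≡ k → ∣ ∁ p ∣ ≡ n ℕ.∸ k
        size≡k⇒∁size≡n∸k p refl = ∣∁p∣≡n∸∣p∣ p
        ∁size≡n∸k⇒size≡k : ∀ p → ∣ ∁ p ∣ ≡ n ℕ.∸ k → ∣ p ∣ ≡ k
        ∁size≡n∸k⇒size≡k p eq = ℕₚ.∸-cancelˡ-≡ (∣p∣≤n p) k≤n (trans (sym (∣∁p∣≡n∸∣p∣ p)) eq)

    binomialMoments : ∀ k → k ℕ.≤ n →
      size ℕ.^ k ℕ.* ∑[ v ∈ allVecs F n ] (𝟙 (v ∈ᶜ? 𝒞) ℕ.* ((n ℕ.∸ weight F v) C k))
        ≡ #code 𝒞 ℕ.* ∑[ u ∈ allVecs F n ] (𝟙 (inDual? 𝒞 u) ℕ.* ((n ℕ.∸ weight F u) C (n ℕ.∸ k)))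
    binomialMoments k k≤n = begin
      size ℕ.^ k ℕ.* ∑[ v ∈ allVecs F n ] (𝟙 (v ∈ᶜ? 𝒞) ℕ.* ((n ℕ.∸ weight F v) C k))
        ≡⟨ cong (size ℕ.^ k ℕ.*_) (∑-#vanishingOn k) ⟨
      size ℕ.^ k ℕ.* ∑[ p ∈ allSubsets n ] (𝟙 (∣ p ∣ ℕ.≟ k) ℕ.* #vanishingOn 𝒞 p)
        ≡⟨ ∑-*ˡ (allSubsets n) (size ℕ.^ k) _ ⟨
      ∑[ p ∈ allSubsets n ] (size ℕ.^ k ℕ.* (𝟙 (∣ p ∣ ℕ.≟ k) ℕ.* #vanishingOn 𝒞 p))
        ≡⟨ ∑-cong (allSubsets n) weigh ⟩
      ∑[ p ∈ allSubsets n ] (#code 𝒞 ℕ.* (𝟙 (∣ p ∣ ℕ.≟ k) ℕ.* #dualSupportedIn 𝒞 p))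
        ≡⟨ ∑-*ˡ (allSubsets n) (#code 𝒞) _ ⟩
      #code 𝒞 ℕ.* ∑[ p ∈ allSubsets n ] (𝟙 (∣ p ∣ ℕ.≟ k) ℕ.* #dualSupportedIn 𝒞 p)
        ≡⟨ cong (#code 𝒞 ℕ.*_) (∑-#dualSupportedIn k k≤n) ⟩
      #code 𝒞 ℕ.* ∑[ u ∈ allVecs F n ] (𝟙 (inDual? 𝒞 u) ℕ.* ((n ℕ.∸ weight F u) C (n ℕ.∸ k))) ∎
      where
      open ≡-Reasoning
      weigh : ∀ p → size ℕ.^ k ℕ.* (𝟙 (∣ p ∣ ℕ.≟ k) ℕ.* #vanishingOn 𝒞 p)
                    ≡ #code 𝒞 ℕ.* (𝟙 (∣ p ∣ ℕ.≟ k) ℕ.* #dualSupportedIn 𝒞 p)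
      weigh p = begin
        size ℕ.^ k ℕ.* (𝟙 (∣ p ∣ ℕ.≟ k) ℕ.* #vanishingOn 𝒞 p)
          ≡⟨ ℕ*.x∙yz≈y∙zx (size ℕ.^ k) (𝟙 (∣ p ∣ ℕ.≟ k)) (#vanishingOn 𝒞 p) ⟩
        𝟙 (∣ p ∣ ℕ.≟ k) ℕ.* (#vanishingOn 𝒞 p ℕ.* size ℕ.^ k)
          ≡⟨ 𝟙-subst (λ m → #vanishingOn 𝒞 p ℕ.* size ℕ.^ m) (∣ p ∣ ℕ.≟ k) ⟨
        𝟙 (∣ p ∣ ℕ.≟ k) ℕ.* (#vanishingOn 𝒞 p ℕ.* size ℕ.^ ∣ p ∣)
          ≡⟨ cong (𝟙 (∣ p ∣ ℕ.≟ k) ℕ.*_) (#vanishingOn-duality 𝒞 p) ⟩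
        𝟙 (∣ p ∣ ℕ.≟ k) ℕ.* (#code 𝒞 ℕ.* #dualSupportedIn 𝒞 p)
          ≡⟨ ℕ*.x∙yz≈y∙xz (𝟙 (∣ p ∣ ℕ.≟ k)) (#code 𝒞) (#dualSupportedIn 𝒞 p) ⟩
        #code 𝒞 ℕ.* (𝟙 (∣ p ∣ ℕ.≟ k) ℕ.* #dualSupportedIn 𝒞 p) ∎

  ∑-zeroOn-full : ∀ n (f : Vec Carrier n → ℕ) →
                  ∑[ v ∈ allVecs F n ] (f v ℕ.* 𝟙 (zeroOn? Subset.⊤ v)) ≡ f (zeros F)
  ∑-zeroOn-full zero    f = trans (ℕₚ.+-identityʳ _) (ℕₚ.*-identityʳ (f []))
  ∑-zeroOn-full (suc n) f = trans (∑-zeroOn-inside Subset.⊤ f) (∑-zeroOn-full n (λ w → f (0# ∷ w)))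

  zeroOn-∁⊤ : ∀ {n} (u : Vec Carrier n) → ZeroOn (∁ Subset.⊤) u
  zeroOn-∁⊤ []      = tt
  zeroOn-∁⊤ (x ∷ u) = zeroOn-∁⊤ u

  module _ {n} (𝒞 : LinearCode F n) (selfDual : SelfDual F 𝒞) where

    𝟙-inDual≡𝟙-∈ᶜ : ∀ u → 𝟙 (inDual? 𝒞 u) ≡ 𝟙 (u ∈ᶜ? 𝒞)
    𝟙-inDual≡𝟙-∈ᶜ u = 𝟙-⇔ (proj₂ selfDual u) (proj₁ selfDual u) (inDual? 𝒞 u) (u ∈ᶜ? 𝒞)

    #code²-selfDual : #code 𝒞 ℕ.* #code 𝒞 ≡ size ℕ.^ n
    #code²-selfDual = begin
      #code 𝒞 ℕ.* #code 𝒞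
        ≡⟨ cong (#code 𝒞 ℕ.*_) #dualSupportedIn-full ⟨
      #code 𝒞 ℕ.* #dualSupportedIn 𝒞 Subset.⊤
        ≡⟨ #vanishingOn-duality 𝒞 Subset.⊤ ⟨
      #vanishingOn 𝒞 Subset.⊤ ℕ.* size ℕ.^ ∣ Subset.⊤ {n} ∣
        ≡⟨ cong₂ (λ a b → a ℕ.* size ℕ.^ b) #vanishingOn-full (∣⊤∣≡n n) ⟩
      1 ℕ.* size ℕ.^ n
        ≡⟨ ℕₚ.*-identityˡ _ ⟩
      size ℕ.^ n ∎
      where
      open ≡-Reasoning
      #vanishingOn-full : #vanishingOn 𝒞 Subset.⊤ ≡ 1
      #vanishingOn-full =
        trans (∑-zeroOn-full n (λ v → 𝟙 (v ∈ᶜ? 𝒞))) (𝟙-yes (LinearCode.zero-mem 𝒞) (zeros F ∈ᶜ? 𝒞))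
      #dualSupportedIn-full : #dualSupportedIn 𝒞 Subset.⊤ ≡ #code 𝒞
      #dualSupportedIn-full = ∑-cong (allVecs F n) (λ u →
        trans (cong (𝟙 (inDual? 𝒞 u) ℕ.*_) (𝟙-yes (zeroOn-∁⊤ u) (zeroOn? (∁ Subset.⊤) u)))
              (trans (ℕₚ.*-identityʳ _) (𝟙-inDual≡𝟙-∈ᶜ u)))

    #code-selfDual : ∀ m → n ≡ m ℕ.+ m → #code 𝒞 ≡ size ℕ.^ m
    #code-selfDual m n≡m+m = square-injective (begin
      #code 𝒞 ℕ.* #code 𝒞        ≡⟨ #code²-selfDual ⟩
      size ℕ.^ n                 ≡⟨ cong (size ℕ.^_) n≡m+m ⟩
      size ℕ.^ (m ℕ.+ m)         ≡⟨ ℕₚ.^-distribˡ-+-* size m m ⟩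
      size ℕ.^ m ℕ.* size ℕ.^ m  ∎)
      where open ≡-Reasoning

    binomialMoments-selfDual : ∀ k → k ℕ.≤ n →
      size ℕ.^ k ℕ.* ∑[ v ∈ allVecs F n ] (𝟙 (v ∈ᶜ? 𝒞) ℕ.* ((n ℕ.∸ weight F v) C k))
        ≡ #code 𝒞 ℕ.* ∑[ v ∈ allVecs F n ] (𝟙 (v ∈ᶜ? 𝒞) ℕ.* ((n ℕ.∸ weight F v) C (n ℕ.∸ k)))
    binomialMoments-selfDual k k≤n = trans (binomialMoments 𝒞 k k≤n)
      (cong (#code 𝒞 ℕ.*_) (∑-cong (allVecs F n) (λ u →
        cong (ℕ._* ((n ℕ.∸ weight F u) C (n ℕ.∸ k))) (𝟙-inDual≡𝟙-∈ᶜ u))))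

  ∑-weightDistribution : ∀ {n} (𝒞 : LinearCode F n) (G : ℕ → ℕ) m → (∀ i → m ℕ.≤ i → G i ≡ 0) →
    ∑[ i ∈ upTo m ] (A F 𝒞 i ℕ.* G i) ≡ ∑[ v ∈ allVecs F n ] (𝟙 (v ∈ᶜ? 𝒞) ℕ.* G (weight F v))
  ∑-weightDistribution {n} 𝒞 G m G-vanishes = begin
    ∑[ i ∈ upTo m ] (A F 𝒞 i ℕ.* G i)
      ≡⟨ ∑-cong (upTo m) (λ i → trans (ℕₚ.*-comm _ (G i)) (cong (G i ℕ.*_) (A-as-∑ i))) ⟩
    ∑[ i ∈ upTo m ] (G i ℕ.* ∑[ v ∈ allVecs F n ] (𝟙 (v ∈ᶜ? 𝒞) ℕ.* 𝟙 (i ℕ.≟ weight F v)))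
      ≡⟨ ∑-*-∑-comm (upTo m) (allVecs F n) G (λ v → 𝟙 (v ∈ᶜ? 𝒞)) (λ i v → 𝟙 (i ℕ.≟ weight F v)) ⟩
    ∑[ v ∈ allVecs F n ] (𝟙 (v ∈ᶜ? 𝒞) ℕ.* ∑[ i ∈ upTo m ] (G i ℕ.* 𝟙 (i ℕ.≟ weight F v)))
      ≡⟨ ∑-cong (allVecs F n) (λ v → cong (𝟙 (v ∈ᶜ? 𝒞) ℕ.*_) (pick (weight F v))) ⟩
    ∑[ v ∈ allVecs F n ] (𝟙 (v ∈ᶜ? 𝒞) ℕ.* G (weight F v)) ∎
    where
    open ≡-Reasoning
    A-as-∑ : ∀ i → A F 𝒞 i ≡ ∑[ v ∈ allVecs F n ] (𝟙 (v ∈ᶜ? 𝒞) ℕ.* 𝟙 (i ℕ.≟ weight F v))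
    A-as-∑ i = trans (length-filter _ (allVecs F n)) (∑-cong (allVecs F n) (λ v →
      trans (𝟙-× (v ∈ᶜ? 𝒞) (weight F v ℕ.≟ i))
            (cong (𝟙 (v ∈ᶜ? 𝒞) ℕ.*_) (𝟙-⇔ sym sym (weight F v ℕ.≟ i) (i ℕ.≟ weight F v)))))
    pick : ∀ w → ∑[ i ∈ upTo m ] (G i ℕ.* 𝟙 (i ℕ.≟ w)) ≡ G w
    pick w = trans (∑-cong (upTo m) (λ i → ℕₚ.*-comm (G i) _)) (pick′ (w ℕ.<? m))
      where
      pick′ : Dec (w ℕ.< m) → ∑[ i ∈ upTo m ] (𝟙 (i ℕ.≟ w) ℕ.* G i) ≡ G w
      pick′ (yes w<m) = ∑-δ (ℕ._≟ w) G (upTo⁺ m) (∈-upTo⁺ w<m)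
      pick′ (no w≮m)  = trans (∑-δ-∉ (ℕ._≟ w) G (w≮m ∘ ∈-upTo⁻)) (sym (G-vanishes w (ℕₚ.≮⇒≥ w≮m)))

open import Data.Nat using (_+_; _*_; _∸_; _^_; _≤_; _<_)
open import Data.Nat.Properties
  using (≤-<-trans; ∸-monoʳ-≤; *-cancelʳ-≡; m^n>0; *-comm; m≤n+m; m+n∸n≡m; m<m+n; +-monoʳ-<; +-suc)

C-vanishes : ∀ {n j k} → n ∸ j < k → ∀ i → j ≤ i → (n ∸ i) C k ≡ 0
C-vanishes {n} n∸j<k i j≤i = k>n⇒nCk≡0 (≤-<-trans (∸-monoʳ-≤ n j≤i) n∸j<k)

2d+4≡[d+2]+[d+2] : ∀ d → 2 * d + 4 ≡ (d + 2) + (d + 2)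
2d+4≡[d+2]+[d+2] = solve-∀

2d+4≡[d+3]+[d+1] : ∀ d → 2 * d + 4 ≡ (d + 3) + (d + 1)
2d+4≡[d+3]+[d+1] = solve-∀

2d+4≡d+[d+4] : ∀ d → 2 * d + 4 ≡ d + (d + 4)
2d+4≡d+[d+4] = solve-∀

d+1≤2d+4 : ∀ d → d + 1 ≤ 2 * d + 4
d+1≤2d+4 d = subst (d + 1 ≤_) (sym (2d+4≡[d+3]+[d+1] d)) (m≤n+m (d + 1) (d + 3))

2d+4∸[d+1]≡d+3 : ∀ d → 2 * d + 4 ∸ (d + 1) ≡ d + 3
2d+4∸[d+1]≡d+3 d = trans (cong (_∸ (d + 1)) (2d+4≡[d+3]+[d+1] d)) (m+n∸n≡m (d + 3) (d + 1))

2d+4∸[d+4]<d+1 : ∀ d → 2 * d + 4 ∸ (d + 4) < d + 1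
2d+4∸[d+4]<d+1 d = subst (_< d + 1) (sym (trans (cong (_∸ (d + 4)) (2d+4≡d+[d+4] d)) (m+n∸n≡m d (d + 4)))) (m<m+n d z<s)

2d+4∸[d+2]<d+3 : ∀ d → 2 * d + 4 ∸ (d + 2) < d + 3
2d+4∸[d+2]<d+3 d = subst (_< d + 3) (sym (trans (cong (_∸ (d + 2)) (2d+4≡[d+2]+[d+2] d)) (m+n∸n≡m (d + 2) (d + 2))))
                         (+-monoʳ-< d (s<s (s<s z<s)))

lemma2p2 : (F : FiniteField) (d : ℕ) (𝒞 : LinearCode F (2 * d + 4))
    → SelfDual F 𝒞 → MinimumDistance F 𝒞 d
    → sum (map (λ i → A F 𝒞 i * ((2 * d + 4 ∸ i) C (d + 1))) (upTo (d + 4)))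
    ≡ FiniteField.size F * sum (map (λ i → A F 𝒞 i * ((2 * d + 4 ∸ i) C (d + 3))) (upTo (d + 2)))
lemma2p2 F d 𝒞 selfDual _ = *-cancelʳ-≡ _ _ (q ^ ν) {{ℕ.>-nonZero (m^n>0 q ν)}} (begin
  L * q ^ ν
    ≡⟨ *-comm L (q ^ ν) ⟩
  q ^ ν * L
    ≡⟨ cong (q ^ ν *_) (∑-weightDistribution 𝒞 _ (d + 4) (C-vanishes (2d+4∸[d+4]<d+1 d))) ⟩
  q ^ ν * M ν
    ≡⟨ binomialMoments-selfDual 𝒞 selfDual ν (d+1≤2d+4 d) ⟩
  #code 𝒞 * M (n ∸ ν)
    ≡⟨ cong₂ _*_ (#code-selfDual 𝒞 selfDual (d + 2) (2d+4≡[d+2]+[d+2] d)) (cong M (2d+4∸[d+1]≡d+3 d)) ⟩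
  q ^ (d + 2) * M (d + 3)
    ≡⟨ cong (q ^ (d + 2) *_) (∑-weightDistribution 𝒞 _ (d + 2) (C-vanishes (2d+4∸[d+2]<d+3 d))) ⟨
  q ^ (d + 2) * R
    ≡⟨ cong (λ k → q ^ k * R) (+-suc d 1) ⟩
  q * q ^ ν * R
    ≡⟨ ℕ*.xy∙z≈xz∙y q (q ^ ν) R ⟩
  q * R * q ^ ν ∎)
  where
  open ≡-Reasoning
  open Codes F
  q = FiniteField.size F
  n = 2 * d + 4
  ν = d + 1
  L = ∑[ i ∈ upTo (d + 4) ] (A F 𝒞 i * ((n ∸ i) C ν))
  R = ∑[ i ∈ upTo (d + 2) ] (A F 𝒞 i * ((n ∸ i) C (d + 3)))
  M : ℕ → ℕ
  M k = ∑[ v ∈ allVecs F n ] (𝟙 (v ∈ᶜ? 𝒞) * ((n ∸ weight F v) C k))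
  instance
    q≢0 : NonZero q
    q≢0 = ℕ.>-nonZero (∈-length (FiniteField.complete F (FiniteField.0# F)))
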